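{- Let $A,B$ be $R$-thin graphs without isolated vertices. Then $S(A\diamond B)=S_L(A)\,\Box\,S_L(B)+S_R(A)\,\Box\,S_R(B)$ if $A,B$ are both bipartite; $S(A\diamond B)=S_L(A)\,\Box\,S(B)+S_R(A)\,\Box\,S(B)$ if $A$ is bipartite and $B$ is non-bipartite; $S(A\diamond B)=S(A)\,\Box\,S_L(B)+S(A)\,\Box\,S_R(B)$ if $B$ is bipartite and $A$ is non-bipartite; $S(A\diamond B)=S(A)\,\Box\,S(B)$ if $A,B$ are both non-bipartite.
   Context: Graphs are simple. $N_G(x)$ is the neighbourhood of $x$; $G$ is $R$-thin if no two distinct vertices have the same neighbourhood. Bipartite graphs come with a fixed bipartition $(L_G,R_G)$. Diamond product: for bipartite $G,H$, $G\diamond H$ has vertex set $(L_G\times L_H)\cup(R_G\times R_H)$; otherwise its vertex set is $V(G)\times V(H)$; in all cases $(a,b)(a',b')$ is an edge iff $aa'\in E(G)$ and $bb'\in E(H)$. The Cartesian product $G\,\Box\,H$ has vertex set $V(G)\times V(H)$ and edges $(a,b)(a',b')$ with ($aa'\in E(G)$ and $b=b'$) or ($a=a'$ and $bb'\in E(H)$); $+$ denotes disjoint union. The Boolean square $G^s$ has vertex set $V(G)$ and edges $xy$ with $N_G(x)\cap N_G(y)\ne\emptyset$. An edge $xy$ of $G^s$ is dispensable if it is a loop, or there is $z\in V(G)$ such that both (1) $N_G(x)\cap N_G(y)\subsetneq N_G(x)\cap N_G(z)$ or $N_G(x)\subsetneq N_G(z)\subsetneq N_G(y)$, and (2) $N_G(y)\cap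 N_G(x)\subsetneq N_G(y)\cap N_G(z)$ or $N_G(y)\subsetneq N_G(z)\subsetneq N_G(x)$ hold. The Cartesian skeleton $S(G)$ is the spanning subgraph of $G^s$ obtained by removing all dispensable edges. For bipartite $G$, $S_L(G)$ and $S_R(G)$ are the subgraphs of $S(G)$ induced on $L_G$ and $R_G$ respectively. -}

module Defs where

open import Level using (0ℓ)
open import Data.Nat using (ℕ)
open import Data.Fin using (Fin)
open import Data.Bool using (Bool; true; false)
open import Data.Empty using (⊥)
open import Data.Product using (Σ; ∃-syntax; _×_; _,_; proj₁; proj₂)
open import Data.Sum using (_⊎_; inj₁; inj₂)
open import Relation.Nullary using (¬_; Dec)
open import Relation.Unary using (Pred; _⊂_; _∩_; _≐_; Satisfiable)
open import Relation.Binary.PropositionalEquality using (_≡_; _≢_)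

record Graph : Set₁ where
  field
    n       : ℕ
    E       : Fin n → Fin n → Set
    E-sym   : ∀ {x y} → E x y → E y x
    E-irr   : ∀ {x} → ¬ E x x
    E-dec   : ∀ x y → Dec (E x y)

open Graph public

module _ {V : Set} (Adj : V → V → Set) where

  Nbh : V → Pred V 0ℓ
  Nbh x = λ w → Adj x w

  -- edge xy of the Boolean square G^s (loops included)
  BoolSq : V → V → Set
  BoolSq x y = Satisfiable (Nbh x ∩ Nbh y)

  Dispensable : V → V → Set
  Dispensable x y =
    x ≡ y ⊎
    (∃[ z ] ( ((Nbh x ∩ Nbh y ⊂ Nbh x ∩ Nbh z) ⊎ (Nbh x ⊂ Nbh z × Nbh z ⊂ Nbh y))
            × ((Nbh y ∩ Nbh x ⊂ Nbh y ∩ Nbh z) ⊎ (Nbh y ⊂ Nbh z × Nbh z ⊂ Nbh x))))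

  Skel : V → V → Set
  Skel x y = BoolSq x y × ¬ Dispensable x y

RThin : Graph → Set
RThin G = ∀ x y → Nbh (E G) x ≐ Nbh (E G) y → x ≡ y

NoIsolated : Graph → Set
NoIsolated G = ∀ x → ∃[ y ] E G x y

-- a bipartition (L,R): side x ≡ true means x ∈ L, side x ≡ false means x ∈ R
record Bipartition (G : Graph) : Set where
  field
    side   : Fin (n G) → Bool
    proper : ∀ {x y} → E G x y → side x ≢ side y

open Bipartition public

Side : {G : Graph} → Bipartition G → Bool → Set
Side {G} β b = Σ (Fin (n G)) (λ x → side β x ≡ b)

SkelSide : {G : Graph} (β : Bipartition G) (b : Bool) → Side β b → Side β b → Set
SkelSide {G} β b u v = Skel (E G) (proj₁ u) (proj₁ v)

_□_ : {X Y : Set} → (X → X → Set) → (Y → Y → Set) → X × Y → X × Y → Set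
(R □ S) (a , b) (a′ , b′) = (R a a′ × b ≡ b′) ⊎ (a ≡ a′ × S b b′)

_⊕_ : {X Y : Set} → (X → X → Set) → (Y → Y → Set) → X ⊎ Y → X ⊎ Y → Set
(R ⊕ S) (inj₁ x) (inj₁ x′) = R x x′
(R ⊕ S) (inj₁ x) (inj₂ y′) = ⊥
(R ⊕ S) (inj₂ y) (inj₁ x′) = ⊥
(R ⊕ S) (inj₂ y) (inj₂ y′) = S y y′

-- general (non-both-bipartite) case: vertex set V(G) × V(H)
◇E : (G H : Graph) → Fin (n G) × Fin (n H) → Fin (n G) × Fin (n H) → Set
◇E G H (a , b) (a′ , b′) = E G a a′ × E H b b′

-- both bipartite: vertex set (L_G × L_H) ∪ (R_G × R_H) (a disjoint union)
◇V : {G H : Graph} → Bipartition G → Bipartition H → Set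
◇V βG βH = (Side βG true × Side βH true) ⊎ (Side βG false × Side βH false)

◇pair : {G H : Graph} (βG : Bipartition G) (βH : Bipartition H) →
        ◇V βG βH → Fin (n G) × Fin (n H)
◇pair βG βH (inj₁ ((a , _) , (b , _))) = a , b
◇pair βG βH (inj₂ ((a , _) , (b , _))) = a , b

◇bE : {G H : Graph} (βG : Bipartition G) (βH : Bipartition H) →
      ◇V βG βH → ◇V βG βH → Set
◇bE {G} {H} βG βH u v = ◇E G H (◇pair βG βH u) (◇pair βG βH v)

-- canonical identifications of V(G)×V(H) with the vertex sets of the
-- right-hand sides in the mixed cases (both are bijections)
embL : {G : Graph} (β : Bipartition G) (Y : Set) →
       (Side β true × Y) ⊎ (Side β false × Y) → Fin (n G) × Y
embL β Y (inj₁ ((a , _) , y)) = a , y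
embL β Y (inj₂ ((a , _) , y)) = a , y

embR : {H : Graph} (β : Bipartition H) (X : Set) →
       (X × Side β true) ⊎ (X × Side β false) → X × Fin (n H)
embR β X (inj₁ (x , (b , _))) = x , b
embR β X (inj₂ (x , (b , _))) = x , b

{-# OPTIONS --safe #-}
module Submission where

-- In the direct product A × B the neighbourhood of (x , y) is N(x) × N(y) with both
-- factors non-empty, so (strict) inclusions between neighbourhoods are read off
-- coordinatewise.  Hence an edge of (A × B)ˢ along one coordinate is dispensable
-- exactly when its projection is, while for an edge (x , y)(x′ , y′) moving both
-- coordinates R-thinness makes a corner, (x , y′) or (x′ , y), witness dispensability.
-- Bipartitions are preserved along edges, so in the bipartite cases the diamond
-- product is a union of components of A × B, the skeleton commutes with restriction
-- to it, and the bipartition splits S(A) □ S(B) into the two summands.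

open import Defs
open import Level using (0ℓ)
open import Data.Bool using (Bool; true; false; not)
import Data.Bool as Bool
open import Data.Bool.Properties using (¬-not)
open import Data.Fin using (Fin; _≟_)
open import Data.Fin.Properties using (all?)
open import Data.Empty using (⊥-elim)
open import Data.Product using (∃-syntax; _×_; _,_; proj₁; proj₂; swap; map)
open import Data.Sum using (_⊎_; inj₁; inj₂)
open import Function.Base using (_on_; _∘_; id; case_of_)
open import Function.Bundles using (_⇔_; mk⇔; Equivalence)
open import Function.Construct.Composition using (_⇔-∘_)
open import Function.Construct.Symmetry using (⇔-sym)
open import Function.Definitions using (Injective)
open import Relation.Nullary using (¬_; Dec; yes; no)
open import Relation.Nullary.Decidable using (map′; _→-dec_)
open import Relation.Unary using (Pred; _⊆_; _⊂_; _∩_; _≐_)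
open import Relation.Unary.Properties using (⊂-respˡ-≐; ⊂-respʳ-≐)
open import Relation.Unary.Algebra using (∩-cong)
open import Relation.Binary.PropositionalEquality using (_≡_; _≢_; refl; sym; trans; cong; cong₂)
open import Axiom.UniquenessOfIdentityProofs using (module Decidable⇒UIP)

-- Condition (1) for the edge xy with witness z; condition (2) is DispCond Adj y x z.
DispCond : {V : Set} (Adj : V → V → Set) → V → V → V → Set
DispCond Adj x y z =
  (Nbh Adj x ∩ Nbh Adj y ⊂ Nbh Adj x ∩ Nbh Adj z) ⊎ (Nbh Adj x ⊂ Nbh Adj z × Nbh Adj z ⊂ Nbh Adj y)

module _ {V : Set} (Adj : V → V → Set) where

  BoolSq-sym : ∀ {x y} → BoolSq Adj x y → BoolSq Adj y x
  BoolSq-sym (w , a , b) = w , b , a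

  Dispensable-sym : ∀ {x y} → Dispensable Adj x y → Dispensable Adj y x
  Dispensable-sym (inj₁ eq)           = inj₁ (sym eq)
  Dispensable-sym (inj₂ (z , c₁ , c₂)) = inj₂ (z , c₂ , c₁)

⊂-cong : {A : Set} {P P′ Q Q′ : Pred A 0ℓ} → P ≐ P′ → Q ≐ Q′ → P ⊂ Q → P′ ⊂ Q′
⊂-cong P≐P′ Q≐Q′ P⊂Q = ⊂-respʳ-≐ Q≐Q′ (⊂-respˡ-≐ P≐P′ P⊂Q)

Skel-⇔ : {V W : Set} {Adj : V → V → Set} {Adj′ : W → W → Set} {x y : V} {x′ y′ : W} →
         BoolSq Adj x y ⇔ BoolSq Adj′ x′ y′ → Dispensable Adj x y ⇔ Dispensable Adj′ x′ y′ →
         Skel Adj x y ⇔ Skel Adj′ x′ y′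
Skel-⇔ sq⇔ disp⇔ = mk⇔
  (map (Equivalence.to sq⇔) (λ nd → nd ∘ Equivalence.from disp⇔))
  (map (Equivalence.from sq⇔) (λ nd → nd ∘ Equivalence.to disp⇔))

Dispensable-resp-Nbh : {V : Set} {Adj Adj′ : V → V → Set} → (∀ x → Nbh Adj x ≐ Nbh Adj′ x) →
                       ∀ {x y} → Dispensable Adj x y → Dispensable Adj′ x y
Dispensable-resp-Nbh _ (inj₁ eq) = inj₁ eq
Dispensable-resp-Nbh {Adj = Adj} {Adj′} N≐N′ (inj₂ (z , c₁ , c₂)) =
  inj₂ (z , DispCond-resp c₁ , DispCond-resp c₂)
  where
    DispCond-resp : ∀ {x y z} → DispCond Adj x y z → DispCond Adj′ x y z
    DispCond-resp {x} {y} {z} (inj₁ ⊂∩) =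
      inj₁ (⊂-cong (∩-cong (N≐N′ x) (N≐N′ y)) (∩-cong (N≐N′ x) (N≐N′ z)) ⊂∩)
    DispCond-resp {x} {y} {z} (inj₂ (x⊂z , z⊂y)) =
      inj₂ (⊂-cong (N≐N′ x) (N≐N′ z) x⊂z , ⊂-cong (N≐N′ z) (N≐N′ y) z⊂y)

Skel-cong : {V : Set} {Adj Adj′ : V → V → Set} → (∀ {x y} → Adj x y ⇔ Adj′ x y) →
            ∀ {x y} → Skel Adj x y ⇔ Skel Adj′ x y
Skel-cong {Adj = Adj} {Adj′} Adj⇔Adj′ = Skel-⇔
  (mk⇔ (map id (map to to)) (map id (map from from)))
  (mk⇔ (Dispensable-resp-Nbh (λ _ → to , from)) (Dispensable-resp-Nbh (λ _ → from , to)))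
  where
    to : ∀ {x y} → Adj x y → Adj′ x y
    to = Equivalence.to Adj⇔Adj′
    from : ∀ {x y} → Adj′ x y → Adj x y
    from = Equivalence.from Adj⇔Adj′

-- Restriction to a union of components

module Restriction {U V : Set} (Adj : V → V → Set) (Adj-sym : ∀ {v w} → Adj v w → Adj w v)
  (nonisolated : ∀ v → ∃[ w ] Adj v w) (f : U → V) (f-injective : Injective _≡_ _≡_ f)
  (closed : ∀ {u w} → Adj (f u) w → ∃[ u′ ] f u′ ≡ w) where

  private
    Image : V → Set
    Image w = ∃[ u ] f u ≡ w

    ⊆-from-image : {P Q : Pred V 0ℓ} → (∀ {w} → P w → Image w) → P ∘ f ⊆ Q ∘ f → P ⊆ Q
    ⊆-from-image im P∘f⊆Q∘f p with im p
    ... | _ , refl = P∘f⊆Q∘f p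

    common-neighbour-image : ∀ {u w z} → Adj (f u) w → Adj z w → Image z
    common-neighbour-image e e′ with closed e
    ... | _ , refl = closed (Adj-sym e′)

    witness-image : ∀ {u v z} → BoolSq Adj (f u) (f v) → DispCond Adj (f u) (f v) z → Image z
    witness-image (w , a , b) (inj₁ (sub , _)) = common-neighbour-image a (proj₂ (sub (a , b)))
    witness-image {u} _ (inj₂ ((sub , _) , _)) =
      common-neighbour-image (proj₂ (nonisolated (f u))) (sub (proj₂ (nonisolated (f u))))

    DispCond-restrict : ∀ {u v u′} → DispCond Adj (f u) (f v) (f u′) → DispCond (Adj on f) u v u′
    DispCond-restrict (inj₁ (sub , nsup)) =
      inj₁ (sub , λ sup → nsup (⊆-from-image (closed ∘ proj₁) sup))
    DispCond-restrict (inj₂ ((sub₁ , nsup₁) , (sub₂ , nsup₂))) =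
      inj₂ ((sub₁ , λ sup → nsup₁ (⊆-from-image closed sup)) ,
            (sub₂ , λ sup → nsup₂ (⊆-from-image closed sup)))

    DispCond-extend : ∀ {u v u′} → DispCond (Adj on f) u v u′ → DispCond Adj (f u) (f v) (f u′)
    DispCond-extend (inj₁ (sub , nsup)) =
      inj₁ (⊆-from-image (closed ∘ proj₁) sub , λ sup → nsup sup)
    DispCond-extend (inj₂ ((sub₁ , nsup₁) , (sub₂ , nsup₂))) =
      inj₂ ((⊆-from-image closed sub₁ , λ sup → nsup₁ sup) ,
            (⊆-from-image closed sub₂ , λ sup → nsup₂ sup))

  Skel-on : ∀ {u v} → Skel (Adj on f) u v ⇔ Skel Adj (f u) (f v)
  Skel-on {u} {v} = mk⇔ to from
    where
      to : Skel (Adj on f) u v → Skel Adj (f u) (f v)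
      to ((w , a , b) , nd) = (f w , a , b) , nd′
        where
          nd′ : ¬ Dispensable Adj (f u) (f v)
          nd′ (inj₁ eq) = nd (inj₁ (f-injective eq))
          nd′ (inj₂ (z , c₁ , c₂)) with witness-image (f w , a , b) c₁
          ... | u′ , refl = nd (inj₂ (u′ , DispCond-restrict c₁ , DispCond-restrict c₂))

      from : Skel Adj (f u) (f v) → Skel (Adj on f) u v
      from ((w , a , b) , nd) with closed a
      ... | w′ , refl = (w′ , a , b) , nd′
        where
          nd′ : ¬ Dispensable (Adj on f) u v
          nd′ (inj₁ refl) = nd (inj₁ refl)
          nd′ (inj₂ (u′ , c₁ , c₂)) = nd (inj₂ (f u′ , DispCond-extend c₁ , DispCond-extend c₂))

-- The direct product

◇E-sym : (A B : Graph) → ∀ {p q} → ◇E A B p q → ◇E A B q p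
◇E-sym A B (e , e′) = E-sym A e , E-sym B e′

◇E-nonisolated : (A B : Graph) → NoIsolated A → NoIsolated B → ∀ p → ∃[ q ] ◇E A B p q
◇E-nonisolated A B noA noB (x , y) = (proj₁ (noA x) , proj₁ (noB y)) , (proj₂ (noA x) , proj₂ (noB y))

Nbh-⊆? : (G : Graph) (x x′ : Fin (n G)) → Dec (Nbh (E G) x ⊆ Nbh (E G) x′)
Nbh-⊆? G x x′ = map′ (λ h {c} → h c) (λ h c → h) (all? (λ c → E-dec G x c →-dec E-dec G x′ c))

module DirectProduct (A B : Graph) (noA : NoIsolated A) (noB : NoIsolated B) where

  private
    P = ◇E A B
    N₁ = Nbh (E A)
    N₂ = Nbh (E B)

    ⊆-fst : ∀ {x x′ y y′} → Nbh P (x , y) ⊆ Nbh P (x′ , y′) → N₁ x ⊆ N₁ x′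
    ⊆-fst {y = y} sub r = proj₁ (sub (r , proj₂ (noB y)))

    ⊆-snd : ∀ {x x′ y y′} → Nbh P (x , y) ⊆ Nbh P (x′ , y′) → N₂ y ⊆ N₂ y′
    ⊆-snd {x = x} sub s = proj₂ (sub (proj₂ (noA x) , s))

    ⊆-pair : ∀ {x x′ y y′} → N₁ x ⊆ N₁ x′ → N₂ y ⊆ N₂ y′ → Nbh P (x , y) ⊆ Nbh P (x′ , y′)
    ⊆-pair sub₁ sub₂ (r , s) = sub₁ r , sub₂ s

    DispCond-◇⁺ : ∀ {x₁ x₂ y z} → DispCond (E A) x₁ x₂ z → DispCond P (x₁ , y) (x₂ , y) (z , y)
    DispCond-◇⁺ {y = y} (inj₁ (sub , nsup)) = inj₁
      ( (λ ((r₁ , s) , (r₂ , _)) → map (_, s) (_, s) (sub (r₁ , r₂)))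
      , λ sup → nsup (λ (r₁ , r) → map proj₁ proj₁ (sup ((r₁ , proj₂ (noB y)) , (r , proj₂ (noB y))))) )
    DispCond-◇⁺ (inj₂ ((sub₁ , nsup₁) , (sub₂ , nsup₂))) = inj₂
      ( (⊆-pair sub₁ id , λ sup → nsup₁ (⊆-fst sup))
      , (⊆-pair sub₂ id , λ sup → nsup₂ (⊆-fst sup)) )

    DispCond-◇⁻ : ∀ {x₁ x₂ y z w} → DispCond P (x₁ , y) (x₂ , y) (z , w) → DispCond (E A) x₁ x₂ z
    DispCond-◇⁻ {y = y} (inj₁ (sub , nsup)) = inj₁
      ( (λ (r₁ , r₂) → map proj₁ proj₁ (sub ((r₁ , proj₂ (noB y)) , (r₂ , proj₂ (noB y)))))
      , λ sup → nsup (λ ((r₁ , s₁) , (r , _)) → map (_, s₁) (_, s₁) (sup (r₁ , r))) )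
    DispCond-◇⁻ (inj₂ ((sub₁ , nsup₁) , (sub₂ , nsup₂))) = inj₂
      ( (⊆-fst sub₁ , λ sup → nsup₁ (⊆-pair sup (⊆-snd sub₂)))
      , (⊆-fst sub₂ , λ sup → nsup₂ (⊆-pair sup (⊆-snd sub₁))) )

    Dispensable-◇ˡ : ∀ {x x′ y} → Dispensable (E A) x x′ ⇔ Dispensable P (x , y) (x′ , y)
    Dispensable-◇ˡ {y = y} = mk⇔ to from
      where
        to : ∀ {x x′} → Dispensable (E A) x x′ → Dispensable P (x , y) (x′ , y)
        to (inj₁ eq)           = inj₁ (cong (_, y) eq)
        to (inj₂ (z , c₁ , c₂)) = inj₂ ((z , y) , DispCond-◇⁺ c₁ , DispCond-◇⁺ c₂)
        from : ∀ {x x′} → Dispensable P (x , y) (x′ , y) → Dispensable (E A) x x′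
        from (inj₁ eq)                 = inj₁ (cong proj₁ eq)
        from (inj₂ ((z , _) , c₁ , c₂)) = inj₂ (z , DispCond-◇⁻ c₁ , DispCond-◇⁻ c₂)

  Skel-◇ˡ : ∀ {x x′ y} → Skel (E A) x x′ ⇔ Skel P (x , y) (x′ , y)
  Skel-◇ˡ {y = y} = Skel-⇔
    (mk⇔ (λ (c , r , r′) → (c , proj₁ (noB y)) , (r , proj₂ (noB y)) , (r′ , proj₂ (noB y)))
         (λ ((c , _) , (r , _) , (r′ , _)) → c , r , r′))
    Dispensable-◇ˡ

  private
    DispCond-corner-∩ : ∀ {x x′ y y′} → BoolSq P (x , y) (x′ , y′) → ¬ N₁ x ⊆ N₁ x′ →
                        DispCond P (x , y) (x′ , y′) (x , y′)
    DispCond-corner-∩ (_ , (_ , s) , (_ , s′)) n = inj₁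
      ( (λ ((r₁ , s₁) , (_ , s₂)) → (r₁ , s₁) , (r₁ , s₂))
      , λ sup → n (λ r → proj₁ (proj₂ (sup ((r , s) , (r , s′))))) )

    DispCond-corner-∩′ : ∀ {x x′ y y′} → BoolSq P (x , y) (x′ , y′) → ¬ N₂ y′ ⊆ N₂ y →
                         DispCond P (x′ , y′) (x , y) (x , y′)
    DispCond-corner-∩′ (_ , (r , _) , (r′ , _)) n = inj₁
      ( (λ ((r₂ , s₂) , (r₁ , _)) → (r₂ , s₂) , (r₁ , s₂))
      , λ sup → n (λ s → proj₂ (proj₂ (sup ((r′ , s) , (r , s))))) )

    DispCond-corner-⊂ : ∀ {x x′ y y′} → N₁ x ⊂ N₁ x′ → N₂ y ⊂ N₂ y′ →
                        DispCond P (x , y) (x′ , y′) (x , y′)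
    DispCond-corner-⊂ (sub₁ , nsup₁) (sub₂ , nsup₂) = inj₂
      ( (⊆-pair id sub₂ , λ sup → nsup₂ (⊆-snd sup))
      , (⊆-pair sub₁ id , λ sup → nsup₁ (⊆-fst sup)) )

    corner-dispensable : ∀ {x x′ y y′} → BoolSq P (x , y) (x′ , y′) →
                         (¬ N₁ x ⊆ N₁ x′) ⊎ (N₁ x ⊂ N₁ x′ × N₂ y ⊆ N₂ y′) → ¬ N₂ y′ ⊆ N₂ y →
                         Dispensable P (x , y) (x′ , y′)
    corner-dispensable {x} {y′ = y′} sq (inj₁ n₁) n₂ =
      inj₂ ((x , y′) , DispCond-corner-∩ sq n₁ , DispCond-corner-∩′ sq n₂)
    corner-dispensable {x} {y′ = y′} sq (inj₂ (x⊂x′ , y⊆y′)) n₂ =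
      inj₂ ((x , y′) , DispCond-corner-⊂ x⊂x′ (y⊆y′ , n₂) , DispCond-corner-∩′ sq n₂)

  off-axis-dispensable : RThin A → RThin B → ∀ {x x′ y y′} → x ≢ x′ → y ≢ y′ →
                         BoolSq P (x , y) (x′ , y′) → Dispensable P (x , y) (x′ , y′)
  off-axis-dispensable thA thB {x} {x′} {y} {y′} x≢x′ y≢y′ sq
    with Nbh-⊆? A x x′ | Nbh-⊆? A x′ x | Nbh-⊆? B y y′ | Nbh-⊆? B y′ y
  ... | no n₁  | _      | _      | no n₂  = corner-dispensable sq (inj₁ n₁) n₂
  ... | _      | no n₁  | no n₂  | _      =
    Dispensable-sym P (corner-dispensable (BoolSq-sym P sq) (inj₁ n₁) n₂)
  ... | yes h₁ | yes h₂ | _      | _      = ⊥-elim (x≢x′ (thA x x′ (h₁ , h₂)))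
  ... | _      | _      | yes h₁ | yes h₂ = ⊥-elim (y≢y′ (thB y y′ (h₁ , h₂)))
  ... | yes h₁ | no n₁  | yes h₂ | no n₂  = corner-dispensable sq (inj₂ ((h₁ , n₁) , h₂)) n₂
  ... | no n₁  | yes h₁ | no n₂  | yes h₂ =
    Dispensable-sym P (corner-dispensable (BoolSq-sym P sq) (inj₂ ((h₁ , n₁) , h₂)) n₂)

Skel-◇-swap : (A B : Graph) → NoIsolated A → NoIsolated B → ∀ {x y x′ y′} →
              Skel (◇E B A) (y , x) (y′ , x′) ⇔ Skel (◇E A B) (x , y) (x′ , y′)
Skel-◇-swap A B noA noB = Swapped.Skel-on ⇔-∘ ⇔-sym (Skel-cong (mk⇔ swap swap))
  where
    module Swapped = Restriction (◇E A B) (◇E-sym A B) (◇E-nonisolated A B noA noB)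
                       swap (cong swap) (λ {_} {w} _ → swap w , refl)

Skel-◇ʳ : (A B : Graph) → NoIsolated A → NoIsolated B → ∀ {x y y′} →
          Skel (E B) y y′ ⇔ Skel (◇E A B) (x , y) (x , y′)
Skel-◇ʳ A B noA noB = Skel-◇-swap A B noA noB ⇔-∘ DirectProduct.Skel-◇ˡ B A noB noA

Skel-◇ : (A B : Graph) → RThin A → RThin B → NoIsolated A → NoIsolated B →
         ∀ p q → Skel (◇E A B) p q ⇔ (Skel (E A) □ Skel (E B)) p q
Skel-◇ A B thA thB noA noB (x , y) (x′ , y′) = mk⇔ to from
  where
    open DirectProduct A B noA noB using (Skel-◇ˡ; off-axis-dispensable)

    to : Skel (◇E A B) (x , y) (x′ , y′) → (Skel (E A) □ Skel (E B)) (x , y) (x′ , y′)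
    to s@(sq , nd) with x ≟ x′ | y ≟ y′
    ... | yes refl | yes refl  = ⊥-elim (nd (inj₁ refl))
    ... | yes refl | no _      = inj₂ (refl , Equivalence.from (Skel-◇ʳ A B noA noB) s)
    ... | no _     | yes refl  = inj₁ (Equivalence.from Skel-◇ˡ s , refl)
    ... | no x≢x′  | no y≢y′   = ⊥-elim (nd (off-axis-dispensable thA thB x≢x′ y≢y′ sq))

    from : (Skel (E A) □ Skel (E B)) (x , y) (x′ , y′) → Skel (◇E A B) (x , y) (x′ , y′)
    from (inj₁ (s , refl)) = Equivalence.to Skel-◇ˡ s
    from (inj₂ (refl , s)) = Equivalence.to (Skel-◇ʳ A B noA noB) s

-- Bipartite graphs

module _ {G : Graph} (β : Bipartition G) where

  side-flip : ∀ {a c} → E G a c → side β c ≡ not (side β a)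
  side-flip e = ¬-not (λ eq → proper β e (sym eq))

  BoolSq-same-side : ∀ {a a′} → BoolSq (E G) a a′ → side β a ≡ side β a′
  BoolSq-same-side (_ , e , e′) = trans (side-flip (E-sym G e)) (sym (side-flip (E-sym G e′)))

  □-same-sideˡ : {Y : Set} (Q : Y → Y → Set) → ∀ {p q} →
                 (Skel (E G) □ Q) p q → side β (proj₁ p) ≡ side β (proj₁ q)
  □-same-sideˡ _ (inj₁ ((sq , _) , _)) = BoolSq-same-side sq
  □-same-sideˡ _ (inj₂ (eq , _))      = cong (side β) eq

  □-same-sideʳ : {X : Set} (Q : X → X → Set) → ∀ {p q} →
                 (Q □ Skel (E G)) p q → side β (proj₂ p) ≡ side β (proj₂ q)
  □-same-sideʳ _ (inj₁ (_ , eq))      = cong (side β) eq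
  □-same-sideʳ _ (inj₂ (_ , (sq , _))) = BoolSq-same-side sq

  Side-injective : ∀ {b} {u v : Side β b} → proj₁ u ≡ proj₁ v → u ≡ v
  Side-injective {u = a , p} {v = .a , q} refl = cong (a ,_) (Decidable⇒UIP.≡-irrelevant Bool._≟_ p q)

□-on : {X X′ Y Y′ : Set} (R : X → X → Set) (S : Y → Y → Set) {g : X′ → X} {h : Y′ → Y} →
       Injective _≡_ _≡_ g → Injective _≡_ _≡_ h →
       ∀ {p q} → ((R on g) □ (S on h)) p q ⇔ (R □ S) (map g h p) (map g h q)
□-on _ _ g-injective h-injective = mk⇔
  (λ { (inj₁ (r , eq)) → inj₁ (r , cong _ eq) ; (inj₂ (eq , s)) → inj₂ (cong _ eq , s) })
  (λ { (inj₁ (r , eq)) → inj₁ (r , h-injective eq) ; (inj₂ (eq , s)) → inj₂ (g-injective eq , s) })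

⊕-⇔ : {U₁ U₂ W : Set} {R₁ : U₁ → U₁ → Set} {R₂ : U₂ → U₂ → Set} {T : W → W → Set}
      (e : U₁ ⊎ U₂ → W) (colour : W → Bool) →
      (∀ {w w′} → T w w′ → colour w ≡ colour w′) →
      (∀ {a} → colour (e (inj₁ a)) ≡ true) → (∀ {b} → colour (e (inj₂ b)) ≡ false) →
      (∀ {a a′} → R₁ a a′ ⇔ T (e (inj₁ a)) (e (inj₁ a′))) →
      (∀ {b b′} → R₂ b b′ ⇔ T (e (inj₂ b)) (e (inj₂ b′))) →
      ∀ u v → (R₁ ⊕ R₂) u v ⇔ T (e u) (e v)
⊕-⇔ _ _ _ _ _ R₁⇔T _ (inj₁ _) (inj₁ _) = R₁⇔T
⊕-⇔ _ _ _ _ _ _ R₂⇔T (inj₂ _) (inj₂ _) = R₂⇔T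
⊕-⇔ _ _ T-colour true₁ false₂ _ _ (inj₁ _) (inj₂ _) =
  mk⇔ ⊥-elim (λ t → case trans (sym true₁) (trans (T-colour t) false₂) of λ ())
⊕-⇔ _ _ T-colour true₁ false₂ _ _ (inj₂ _) (inj₁ _) =
  mk⇔ ⊥-elim (λ t → case trans (sym true₁) (trans (sym (T-colour t)) false₂) of λ ())

□-⊕-◇pair : {G H : Graph} (βG : Bipartition G) (βH : Bipartition H) → ∀ u v →
            ((SkelSide βG true □ SkelSide βH true) ⊕ (SkelSide βG false □ SkelSide βH false)) u v
              ⇔ (Skel (E G) □ Skel (E H)) (◇pair βG βH u) (◇pair βG βH v)
□-⊕-◇pair {G} {H} βG βH =
  ⊕-⇔ (◇pair βG βH) (side βG ∘ proj₁) (□-same-sideˡ βG (Skel (E H)))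
      (λ {a} → proj₂ (proj₁ a)) (λ {b} → proj₂ (proj₁ b))
      (□-on (Skel (E G)) (Skel (E H)) (Side-injective βG) (Side-injective βH))
      (□-on (Skel (E G)) (Skel (E H)) (Side-injective βG) (Side-injective βH))

□-⊕-embL : {G : Graph} (β : Bipartition G) {Y : Set} (S : Y → Y → Set) → ∀ u v →
           ((SkelSide β true □ S) ⊕ (SkelSide β false □ S)) u v
             ⇔ (Skel (E G) □ S) (embL β Y u) (embL β Y v)
□-⊕-embL {G} β S =
  ⊕-⇔ (embL β _) (side β ∘ proj₁) (□-same-sideˡ β S)
      (λ {a} → proj₂ (proj₁ a)) (λ {b} → proj₂ (proj₁ b))
      (□-on (Skel (E G)) S (Side-injective β) id) (□-on (Skel (E G)) S (Side-injective β) id)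

□-⊕-embR : {G : Graph} (β : Bipartition G) {X : Set} (R : X → X → Set) → ∀ u v →
           ((R □ SkelSide β true) ⊕ (R □ SkelSide β false)) u v
             ⇔ (R □ Skel (E G)) (embR β X u) (embR β X v)
□-⊕-embR {G} β R =
  ⊕-⇔ (embR β _) (side β ∘ proj₂) (□-same-sideʳ β R)
      (λ {a} → proj₂ (proj₂ a)) (λ {b} → proj₂ (proj₂ b))
      (□-on R (Skel (E G)) id (Side-injective β)) (□-on R (Skel (E G)) id (Side-injective β))

module _ {A B : Graph} (βA : Bipartition A) (βB : Bipartition B) where

  private
    Balanced : Fin (n A) × Fin (n B) → Set
    Balanced (a , b) = side βA a ≡ side βB b

    ◇pair-balanced : ∀ u → Balanced (◇pair βA βB u)
    ◇pair-balanced (inj₁ ((_ , pa) , (_ , pb))) = trans pa (sym pb)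
    ◇pair-balanced (inj₂ ((_ , pa) , (_ , pb))) = trans pa (sym pb)

    ◇E-balanced : ∀ {p q} → Balanced p → ◇E A B p q → Balanced q
    ◇E-balanced bal (e , e′) = trans (side-flip βA e) (trans (cong not bal) (sym (side-flip βB e′)))

    balanced-image : ∀ {p} → Balanced p → ∃[ u ] ◇pair βA βB u ≡ p
    balanced-image {a , b} bal with side βA a in pa
    ... | true  = inj₁ ((a , pa) , (b , sym bal)) , refl
    ... | false = inj₂ ((a , pa) , (b , sym bal)) , refl

    ◇pair-injective : Injective _≡_ _≡_ (◇pair βA βB)
    ◇pair-injective {inj₁ (a , b)} {inj₁ (a′ , b′)} eq =
      cong inj₁ (cong₂ _,_ (Side-injective βA (cong proj₁ eq)) (Side-injective βB (cong proj₂ eq)))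
    ◇pair-injective {inj₂ (a , b)} {inj₂ (a′ , b′)} eq =
      cong inj₂ (cong₂ _,_ (Side-injective βA (cong proj₁ eq)) (Side-injective βB (cong proj₂ eq)))
    ◇pair-injective {inj₁ ((_ , pa) , _)} {inj₂ ((_ , pa′) , _)} eq =
      case trans (sym pa) (trans (cong (side βA ∘ proj₁) eq) pa′) of λ ()
    ◇pair-injective {inj₂ ((_ , pa) , _)} {inj₁ ((_ , pa′) , _)} eq =
      case trans (sym pa′) (trans (cong (side βA ∘ proj₁) (sym eq)) pa) of λ ()

  Skel-◇ᵇ : NoIsolated A → NoIsolated B →
            ∀ {u v} → Skel (◇bE βA βB) u v ⇔ Skel (◇E A B) (◇pair βA βB u) (◇pair βA βB v)
  Skel-◇ᵇ noA noB = Restriction.Skel-on (◇E A B) (◇E-sym A B) (◇E-nonisolated A B noA noB)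
    (◇pair βA βB) ◇pair-injective (λ {u} e → balanced-image (◇E-balanced (◇pair-balanced u) e))

proposition5p14 : (A B : Graph) → RThin A → RThin B → NoIsolated A → NoIsolated B →
    ( ((βA : Bipartition A) (βB : Bipartition B) → ∀ u v →
        Skel (◇bE βA βB) u v
          ⇔ ((SkelSide βA true □ SkelSide βB true) ⊕ (SkelSide βA false □ SkelSide βB false)) u v)
    × ((βA : Bipartition A) → ¬ Bipartition B → ∀ u v →
        Skel (◇E A B) (embL βA _ u) (embL βA _ v)
          ⇔ ((SkelSide βA true □ Skel (E B)) ⊕ (SkelSide βA false □ Skel (E B))) u v)
    × (¬ Bipartition A → (βB : Bipartition B) → ∀ u v →
        Skel (◇E A B) (embR βB _ u) (embR βB _ v)
          ⇔ ((Skel (E A) □ SkelSide βB true) ⊕ (Skel (E A) □ SkelSide βB false)) u v)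
    × (¬ Bipartition A → ¬ Bipartition B → ∀ u v →
        Skel (◇E A B) u v ⇔ (Skel (E A) □ Skel (E B)) u v) )
proposition5p14 A B thA thB noA noB =
    (λ βA βB u v → ⇔-sym (□-⊕-◇pair βA βB u v) ⇔-∘ (product _ _ ⇔-∘ Skel-◇ᵇ βA βB noA noB))
  , (λ βA _ u v → ⇔-sym (□-⊕-embL βA (Skel (E B)) u v) ⇔-∘ product _ _)
  , (λ _ βB u v → ⇔-sym (□-⊕-embR βB (Skel (E A)) u v) ⇔-∘ product _ _)
  , (λ _ _ → product)
  where
    product : ∀ p q → Skel (◇E A B) p q ⇔ (Skel (E A) □ Skel (E B)) p q
    product = Skel-◇ A B thA thB noA noB
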